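{- Let $\Pi_1$ and $\Pi_2$ be ELPs with the same SE-function, $\mathcal{SE}_{\Pi_1}=\mathcal{SE}_{\Pi_2}$. Then $\Pi_1$ and $\Pi_2$ have the same candidate world views, and hence also the same world views.
   Context: Literals over a set of atoms $\mathcal{A}$ are atoms or their default negations $\neg a$. An interpretation is $I\subseteq\mathcal{A}$; $I\models a$ iff $a\in I$, $I\models\neg\varphi$ iff $I\not\models\varphi$. A logic program is a pair $(\mathcal{A},\mathcal{R})$ with rules $a_1\vee\cdots\vee a_l\leftarrow a_{l+1},\ldots,a_m,\neg\ell_1,\ldots,\neg\ell_n$ ($\ell_i$ literals); $I$ is a model of a rule if, whenever $I$ satisfies all body elements, $I$ contains some head atom; $\mathrm{Mods}(\Pi)$ is the set of models. The GL-reduct $\Pi^I$ consists of $\mathrm{head}(r)\leftarrow\mathrm{pbody}(r)$ for the rules $r$ with $I\models\neg\ell$ for all $\neg\ell$ in the body. $M$ is an answer set if $M\in\mathrm{Mods}(\Pi)$ and no $M'\subsetneq M$ is in $\mathrm{Mods}(\Pi^M)$; $\mathrm{AS}(\Pi)$ is the set of answer sets. An SE-model of a logic program $\Pi$ is $(X,Y)$ with $X\subseteq Y\subseteq\mathcal{A}$, $Y\models\Pi$, $X\models\Pi^Y$; $\mathrm{SE}(\Pi)$ is the set of SE-models. An epistemic literal is $\mathbf{not}\,\ell$. An ELP is $(\mathcal{A},\mathcal{E},\mathcal{R})$, $\mathcal{E}$ a set of epistemic literals over $\mathcal{A}$, rules $a_1\vee\cdots\vee a_k\leftarrow\ell_1,\ldots,\ell_m,\xi_1,\ldots,\xi_j,\neg\xi_{j+1},\ldots,\neg\xi_n$,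 $\xi_i\in\mathcal{E}$. A guess is $\Phi\subseteq\mathcal{E}$. $\mathcal{I}$ is $\Phi$-compatible w.r.t. $\mathcal{E}$ iff $\mathcal{I}\neq\emptyset$, each $\mathbf{not}\,\ell\in\Phi$ has some $I\in\mathcal{I}$ with $I\not\models\ell$, and each $\mathbf{not}\,\ell\in\mathcal{E}\setminus\Phi$ has $I\models\ell$ for all $I\in\mathcal{I}$. The epistemic reduct $\Pi^\Phi$ replaces each $\mathbf{not}\,\ell\in\Phi$ by $\top$ and every remaining $\mathbf{not}$ by $\neg$ ($\neg\neg\neg a$ treated as $\neg a$). $\mathcal{M}$ is a candidate world view (CWV) of $\Pi$ (with associated guess $\Phi$) if $\mathcal{M}=\mathrm{AS}(\Pi^\Phi)$ and $\mathcal{M}$ is $\Phi$-compatible w.r.t. $\mathcal{E}$. A CWV is a world view (WV) if its associated guess $\Phi$ is subset-maximal, i.e. there is no CWV with associated guess $\Phi'\supsetneq\Phi$. $\Phi$ is realizable in $\Pi$ iff some subset of $\mathrm{Mods}(\Pi^\Phi)$ is $\Phi$-compatible w.r.t. $\mathcal{E}$. The SE-function is $\mathcal{SE}_\Pi(\Phi)=\mathrm{SE}(\Pi^\Phi)$ if $\Phi$ is realizable in $\Pi$, and $\emptyset$ otherwise. -}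

module Defs where

open import Data.Nat using (ℕ)
open import Data.Fin using (Fin)
open import Data.Fin.Subset using (Subset; _∈_; _⊆_; _⊂_)
open import Data.Vec using (lookup)
open import Data.Bool using (Bool; true; false; not; T; if_then_else_)
open import Data.List using (List; []; _∷_; _++_)
open import Data.List.Relation.Unary.All using (All)
open import Data.List.Relation.Unary.Any using (Any)
open import Data.Product using (Σ; ∃; _×_; _,_)
open import Data.Unit using (⊤)
open import Relation.Nullary using (¬_)
open import Function.Bundles using (_⇔_)

private variable n : ℕ

Interp : ℕ → Set
Interp n = Subset n

-- Logic programs (disjunctive, with default negation).
-- Negated body elements are ¬φ where φ is one of: an atom a, ¬a, or ⊤
-- (the latter arises from the epistemic reduct as ¬⊤).

data Fml (n : ℕ) : Set where
  atom : Fin n → Fml n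
  top  : Fml n
  nt   : Fml n → Fml n

_⊨F_ : Interp n → Fml n → Set
I ⊨F atom a = a ∈ I
I ⊨F top    = ⊤
I ⊨F nt φ   = ¬ (I ⊨F φ)

evalF : Interp n → Fml n → Bool
evalF I (atom a) = lookup I a
evalF I top      = true
evalF I (nt φ)   = not (evalF I φ)

-- head(r) ← pbody(r), ¬φ for φ ∈ nbody(r)
record Rule (n : ℕ) : Set where
  constructor rule
  field
    head  : List (Fin n)
    pbody : List (Fin n)
    nbody : List (Fml n)
open Rule public

LP : ℕ → Set
LP n = List (Rule n)

_⊨r_ : Interp n → Rule n → Set
I ⊨r r = All (_∈ I) (pbody r) → All (λ φ → ¬ (I ⊨F φ)) (nbody r) → Any (_∈ I) (head r)

_⊨P_ : Interp n → LP n → Set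
I ⊨P Π = All (I ⊨r_) Π

Mods : LP n → Interp n → Set
Mods Π I = I ⊨P Π

allNegTrue : Interp n → List (Fml n) → Bool
allNegTrue I []       = true
allNegTrue I (φ ∷ φs) = if evalF I φ then false else allNegTrue I φs

GL : LP n → Interp n → LP n
GL []       I = []
GL (r ∷ Π)  I = if allNegTrue I (nbody r)
                  then rule (head r) (pbody r) [] ∷ GL Π I
                  else GL Π I

AnswerSet : LP n → Interp n → Set
AnswerSet Π M = M ⊨P Π × (∀ M′ → M′ ⊂ M → ¬ (M′ ⊨P GL Π M))

SEModel : LP n → Interp n → Interp n → Set
SEModel Π X Y = X ⊆ Y × Y ⊨P Π × X ⊨P GL Π Y

data Lit (n : ℕ) : Set where
  pos : Fin n → Lit n
  neg : Fin n → Lit n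

_⊨L_ : Interp n → Lit n → Set
I ⊨L pos a = a ∈ I
I ⊨L neg a = ¬ (a ∈ I)

data ELit (n : ℕ) : Set where
  NOT : Lit n → ELit n

-- a₁ ∨ … ∨ aₖ ← ℓ₁,…,ℓₘ, ξ₁,…,ξⱼ, ¬ξⱼ₊₁,…,¬ξₙ
record ERule (n : ℕ) : Set where
  constructor erule
  field
    ehead : List (Fin n)
    lits  : List (Lit n)
    epos  : List (ELit n)
    eneg  : List (ELit n)
open ERule public

-- An ELP (A, E, R) with A = Fin n and E given by its characteristic
-- function; all epistemic literals occurring in rules belong to E.
record ELP (n : ℕ) (E : ELit n → Bool) : Set where
  constructor elp
  field
    rules : List (ERule n)
    wf    : All (λ r → All (λ ξ → T (E ξ)) (epos r ++ eneg r)) rules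
open ELP public

Guess : (n : ℕ) → (ELit n → Bool) → Set
Guess n E = Σ (ELit n → Bool) λ Φ → ∀ ξ → T (Φ ξ) → T (E ξ)

_∈G_ : ∀ {E : ELit n → Bool} → ELit n → Guess n E → Set
ξ ∈G (Φ , _) = T (Φ ξ)

Compatible : (E : ELit n → Bool) → Guess n E → (Interp n → Set) → Set
Compatible E Φ 𝓘 =
    (∃ λ I → 𝓘 I)
  × (∀ ℓ → NOT ℓ ∈G Φ → ∃ λ I → 𝓘 I × ¬ (I ⊨L ℓ))
  × (∀ ℓ → T (E (NOT ℓ)) → ¬ (NOT ℓ ∈G Φ) → ∀ I → 𝓘 I → I ⊨L ℓ)

posLits : List (Lit n) → List (Fin n)
posLits []            = []
posLits (pos a ∷ ls)  = a ∷ posLits ls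
posLits (neg a ∷ ls)  = posLits ls

negLits : List (Lit n) → List (Fml n)
negLits []            = []
negLits (pos a ∷ ls)  = negLits ls
negLits (neg a ∷ ls)  = atom a ∷ negLits ls

-- φ such that ¬φ is "¬ℓ"
negOf : Lit n → Fml n
negOf (pos a) = atom a
negOf (neg a) = nt (atom a)

-- φ such that ¬φ is "¬¬ℓ" (with ¬¬¬a read as ¬a)
dnegOf : Lit n → Fml n
dnegOf (pos a) = nt (atom a)
dnegOf (neg a) = atom a

-- ξ = not ℓ in the body: ⊤ if ξ ∈ Φ (dropped), else ¬ℓ
redPos : (ELit n → Bool) → List (ELit n) → List (Fml n)
redPos Φ []             = []
redPos Φ (NOT ℓ ∷ ξs)   = if Φ (NOT ℓ) then redPos Φ ξs else negOf ℓ ∷ redPos Φ ξs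

-- ¬ξ in the body: ¬⊤ if ξ ∈ Φ, else ¬¬ℓ
redNeg : (ELit n → Bool) → List (ELit n) → List (Fml n)
redNeg Φ []             = []
redNeg Φ (NOT ℓ ∷ ξs)   = if Φ (NOT ℓ) then top ∷ redNeg Φ ξs else dnegOf ℓ ∷ redNeg Φ ξs

reductRule : (ELit n → Bool) → ERule n → Rule n
reductRule Φ r = rule (ehead r) (posLits (lits r))
                      (negLits (lits r) ++ redPos Φ (epos r) ++ redNeg Φ (eneg r))

reductRules : (ELit n → Bool) → List (ERule n) → LP n
reductRules Φ []       = []
reductRules Φ (r ∷ rs) = reductRule Φ r ∷ reductRules Φ rs

_^E_ : ∀ {E : ELit n → Bool} → ELP n E → Guess n E → LP n
Π ^E (Φ , _) = reductRules Φ (rules Π)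

-- Candidate world view with associated guess Φ (sets of interpretations
-- are predicates; M = AS(Π^Φ) is extensional equality)
CWV : ∀ {E : ELit n → Bool} → ELP n E → Guess n E → (Interp n → Set) → Set
CWV {E = E} Π Φ 𝓜 = (∀ I → 𝓜 I ⇔ AnswerSet (Π ^E Φ) I) × Compatible E Φ 𝓜

_⊋G_ : ∀ {E : ELit n → Bool} → Guess n E → Guess n E → Set
Φ′ ⊋G Φ = (∀ ξ → ξ ∈G Φ → ξ ∈G Φ′) × (∃ λ ξ → ξ ∈G Φ′ × ¬ (ξ ∈G Φ))

WV : ∀ {E : ELit n → Bool} → ELP n E → Guess n E → (Interp n → Set) → Set₁
WV {E = E} Π Φ 𝓜 =
  CWV Π Φ 𝓜 × ¬ (Σ (Guess _ E) λ Φ′ → Φ′ ⊋G Φ × Σ (Interp _ → Set) λ 𝓜′ → CWV Π Φ′ 𝓜′)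

Realizable : ∀ {E : ELit n → Bool} → ELP n E → Guess n E → Set₁
Realizable {n = n} {E = E} Π Φ =
  Σ (Interp n → Set) λ 𝓘 → (∀ I → 𝓘 I → Mods (Π ^E Φ) I) × Compatible E Φ 𝓘

SEfun : ∀ {E : ELit n → Bool} → ELP n E → Guess n E → Interp n → Interp n → Set₁
SEfun Π Φ X Y = Realizable Π Φ × SEModel (Π ^E Φ) X Y

module Submission where

-- The proof lifts the classical fact that strongly equivalent logic programs
-- have the same answer sets to epistemic programs.
--   * Answer sets are determined by SE-models: M is an answer set of P iff
--     (M,M) is an SE-model of P and no (M′,M) with M′ ⊊ M is one.  This needs
--     that every model Y of P is a model of its GL-reduct P^Y, which in turn
--     needs that the Boolean evaluation computing the reduct reflects
--     satisfaction.  Hence SE-equivalent programs have the same answer sets.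
--   * Realizability of a guess Φ is visible in the SE-function: a realizable
--     Φ yields a diagonal SE-model (I,I), so it transfers along equal
--     SE-functions; and for a guess realizable in Π₁ the reducts Π₁^Φ and
--     Π₂^Φ are therefore SE-equivalent.
--   * The guess of a candidate world view is realizable, so AS(Π₁^Φ) =
--     AS(Π₂^Φ) and candidate world views transfer.  World views are defined
--     from candidate world views alone, so they transfer as well.

open import Defs
open import Data.Nat using (ℕ)
open import Data.Bool using (Bool; true; false)
open import Data.Bool.Properties using (not-¬)
open import Data.Fin using (Fin)
open import Data.Fin.Subset using (_∈_; _⊂_)
open import Data.Fin.Subset.Properties using (⊆-refl)
open import Data.Vec using (lookup)
open import Data.Vec.Properties using ([]=⇒lookup; lookup⇒[]=)
open import Data.List using (List; []; _∷_)
open import Data.List.Relation.Unary.All using (All; []; _∷_)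
open import Data.Product using (∃; _×_; _,_; proj₁; proj₂)
open import Data.Unit using (tt)
open import Function using (_∘_)
open import Function.Bundles using (_⇔_; mk⇔; Equivalence)
open import Function.Properties.Equivalence using () renaming (sym to ⇔-sym; trans to ⇔-trans)
open import Relation.Binary.PropositionalEquality using (_≡_)
open import Relation.Nullary using (¬_)
open import Relation.Nullary.Reflects using (Reflects; ofʸ; ofⁿ; ¬-reflects)

open Equivalence

private variable
  n : ℕ
  E : ELit n → Bool

membership-reflects : (I : Interp n) (a : Fin n) → Reflects (a ∈ I) (lookup I a)
membership-reflects I a with lookup I a in eq
... | true  = ofʸ (lookup⇒[]= a I eq)
... | false = ofⁿ (not-¬ eq ∘ []=⇒lookup)

evalF-reflects : (I : Interp n) (φ : Fml n) → Reflects (I ⊨F φ) (evalF I φ)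
evalF-reflects I (atom a) = membership-reflects I a
evalF-reflects I top      = ofʸ tt
evalF-reflects I (nt φ)   = ¬-reflects (evalF-reflects I φ)

allNegTrue-sound : (I : Interp n) (φs : List (Fml n)) →
                   allNegTrue I φs ≡ true → All (λ φ → ¬ (I ⊨F φ)) φs
allNegTrue-sound I []       _ = []
allNegTrue-sound I (φ ∷ φs) ok with evalF I φ | evalF-reflects I φ
... | false | ofⁿ ¬I⊨φ = ¬I⊨φ ∷ allNegTrue-sound I φs ok
allNegTrue-sound I (φ ∷ φs) () | true | _

-- A model Y of P is a model of its GL-reduct P^Y: the kept rules are
-- exactly those whose negative body Y satisfies.
model⇒reduct-model : (Y : Interp n) (P : LP n) → Y ⊨P P → Y ⊨P GL P Y
model⇒reduct-model Y []      []            = []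
model⇒reduct-model Y (r ∷ P) (Y⊨r ∷ Y⊨P) with allNegTrue Y (nbody r) in kept
... | true  = (λ pos _ → Y⊨r pos (allNegTrue-sound Y (nbody r) kept))
              ∷ model⇒reduct-model Y P Y⊨P
... | false = model⇒reduct-model Y P Y⊨P

model⇒diagonal-SE : (P : LP n) (Y : Interp n) → Y ⊨P P → SEModel P Y Y
model⇒diagonal-SE P Y Y⊨P = ⊆-refl , Y⊨P , model⇒reduct-model Y P Y⊨P

answerSet⇔SE : (P : LP n) (M : Interp n) →
               AnswerSet P M ⇔ (SEModel P M M × (∀ M′ → M′ ⊂ M → ¬ SEModel P M′ M))
answerSet⇔SE P M = mk⇔
  (λ (M⊨P , minimal) → model⇒diagonal-SE P M M⊨P ,
                        λ M′ M′⊂M (_ , _ , M′⊨Pᴹ) → minimal M′ M′⊂M M′⊨Pᴹ)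
  (λ ((_ , M⊨P , _) , minimal) → M⊨P ,
                        λ M′ M′⊂M M′⊨Pᴹ → minimal M′ M′⊂M (proj₁ M′⊂M , M⊨P , M′⊨Pᴹ))

SEEquivalent : LP n → LP n → Set
SEEquivalent P₁ P₂ = ∀ X Y → SEModel P₁ X Y ⇔ SEModel P₂ X Y

SEEquivalent⇒sameAS : (P₁ P₂ : LP n) → SEEquivalent P₁ P₂ →
                      ∀ M → AnswerSet P₁ M ⇔ AnswerSet P₂ M
SEEquivalent⇒sameAS P₁ P₂ P₁≡ˢᵉP₂ M =
  ⇔-trans (answerSet⇔SE P₁ M) (⇔-trans sameCharacterisation (⇔-sym (answerSet⇔SE P₂ M)))
  where
  sameCharacterisation : (SEModel P₁ M M × (∀ M′ → M′ ⊂ M → ¬ SEModel P₁ M′ M))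
                       ⇔ (SEModel P₂ M M × (∀ M′ → M′ ⊂ M → ¬ SEModel P₂ M′ M))
  sameCharacterisation = mk⇔
    (λ (se , minimal) → to (P₁≡ˢᵉP₂ M M) se ,
                        λ M′ M′⊂M se′ → minimal M′ M′⊂M (from (P₁≡ˢᵉP₂ M′ M) se′))
    (λ (se , minimal) → from (P₁≡ˢᵉP₂ M M) se ,
                        λ M′ M′⊂M se′ → minimal M′ M′⊂M (to (P₁≡ˢᵉP₂ M′ M) se′))

SameSEfunction : (Π₁ Π₂ : ELP n E) → Set₁
SameSEfunction {n = n} {E = E} Π₁ Π₂ =
  ∀ (Φ : Guess n E) (X Y : Interp n) → SEfun Π₁ Φ X Y ⇔ SEfun Π₂ Φ X Y

SameSEfunction-sym : (Π₁ Π₂ : ELP n E) → SameSEfunction Π₁ Π₂ → SameSEfunction Π₂ Π₁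
SameSEfunction-sym Π₁ Π₂ same Φ X Y = ⇔-sym (same Φ X Y)

-- A realizable guess is witnessed by a diagonal point of the SE-function:
-- any member I of a compatible set of models gives (I,I).
realizable⇒diagonal-SEfun : (Π : ELP n E) (Φ : Guess n E) →
                            Realizable Π Φ → ∃ λ I → SEfun Π Φ I I
realizable⇒diagonal-SEfun Π Φ realizable@(_ , mods , (I , I∈𝓘) , _) =
  I , realizable , model⇒diagonal-SE (Π ^E Φ) I (mods I I∈𝓘)

realizable-transfer : (Π₁ Π₂ : ELP n E) → SameSEfunction Π₁ Π₂ →
                      ∀ Φ → Realizable Π₁ Φ → Realizable Π₂ Φ
realizable-transfer Π₁ Π₂ same Φ realizable =
  let (I , se) = realizable⇒diagonal-SEfun Π₁ Φ realizable
  in proj₁ (to (same Φ I I) se)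

reducts-SEEquivalent : (Π₁ Π₂ : ELP n E) → SameSEfunction Π₁ Π₂ →
                       ∀ Φ → Realizable Π₁ Φ → SEEquivalent (Π₁ ^E Φ) (Π₂ ^E Φ)
reducts-SEEquivalent Π₁ Π₂ same Φ realizable₁ X Y = mk⇔
  (λ se → proj₂ (to (same Φ X Y) (realizable₁ , se)))
  (λ se → proj₂ (from (same Φ X Y) (realizable₂ , se)))
  where
  realizable₂ : Realizable Π₂ Φ
  realizable₂ = realizable-transfer Π₁ Π₂ same Φ realizable₁

-- The guess of a candidate world view is realizable, witnessed by the world
-- view itself (answer sets are models).
CWV⇒realizable : (Π : ELP n E) (Φ : Guess n E) (𝓜 : Interp n → Set) →
                 CWV Π Φ 𝓜 → Realizable Π Φ
CWV⇒realizable Π Φ 𝓜 (𝓜=AS , compatible) =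
  𝓜 , (λ I I∈𝓜 → proj₁ (to (𝓜=AS I) I∈𝓜)) , compatible

CWV-transfer : (Π₁ Π₂ : ELP n E) → SameSEfunction Π₁ Π₂ →
               ∀ Φ 𝓜 → CWV Π₁ Φ 𝓜 → CWV Π₂ Φ 𝓜
CWV-transfer Π₁ Π₂ same Φ 𝓜 cwv@(𝓜=AS₁ , compatible) =
  (λ I → ⇔-trans (𝓜=AS₁ I) (sameAS I)) , compatible
  where
  sameAS : ∀ I → AnswerSet (Π₁ ^E Φ) I ⇔ AnswerSet (Π₂ ^E Φ) I
  sameAS = SEEquivalent⇒sameAS (Π₁ ^E Φ) (Π₂ ^E Φ)
             (reducts-SEEquivalent Π₁ Π₂ same Φ (CWV⇒realizable Π₁ Φ 𝓜 cwv))

WV-transfer : (Π₁ Π₂ : ELP n E) →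
              (∀ Φ 𝓜 → CWV Π₁ Φ 𝓜 ⇔ CWV Π₂ Φ 𝓜) →
              ∀ Φ 𝓜 → WV Π₁ Φ 𝓜 → WV Π₂ Φ 𝓜
WV-transfer Π₁ Π₂ sameCWV Φ 𝓜 (cwv , maximal) =
  to (sameCWV Φ 𝓜) cwv ,
  λ (Φ′ , Φ′⊋Φ , 𝓜′ , cwv′) → maximal (Φ′ , Φ′⊋Φ , 𝓜′ , from (sameCWV Φ′ 𝓜′) cwv′)

lemma2 : ∀ {n : ℕ} {E : ELit n → Bool} (Π₁ Π₂ : ELP n E) →
    (∀ (Φ : Guess n E) (X Y : Interp n) → SEfun Π₁ Φ X Y ⇔ SEfun Π₂ Φ X Y) →
    (∀ (Φ : Guess n E) (𝓜 : Interp n → Set) → CWV Π₁ Φ 𝓜 ⇔ CWV Π₂ Φ 𝓜)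
    × (∀ (Φ : Guess n E) (𝓜 : Interp n → Set) → WV Π₁ Φ 𝓜 ⇔ WV Π₂ Φ 𝓜)
lemma2 Π₁ Π₂ same = sameCWV , sameWV
  where
  sameCWV : ∀ Φ 𝓜 → CWV Π₁ Φ 𝓜 ⇔ CWV Π₂ Φ 𝓜
  sameCWV Φ 𝓜 = mk⇔ (CWV-transfer Π₁ Π₂ same Φ 𝓜)
                    (CWV-transfer Π₂ Π₁ (SameSEfunction-sym Π₁ Π₂ same) Φ 𝓜)

  sameWV : ∀ Φ 𝓜 → WV Π₁ Φ 𝓜 ⇔ WV Π₂ Φ 𝓜
  sameWV Φ 𝓜 = mk⇔ (WV-transfer Π₁ Π₂ sameCWV Φ 𝓜)
                   (WV-transfer Π₂ Π₁ (λ Φ′ 𝓜′ → ⇔-sym (sameCWV Φ′ 𝓜′)) Φ 𝓜)
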